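{- Let $\mathcal{X}$ be a symmetric configuration $v_3$ having a blocking set $Q$ of cardinality $q$, where $\lceil v/3\rceil\leq q<\lfloor v/2\rfloor$. Then $\mathcal{X}$ also has a blocking set of cardinality $q+1$.
   Context: A symmetric configuration $v_3$ is a finite incidence structure consisting of a set $V$ of $v$ points and a collection of $v$ blocks, each block a $3$-element subset of $V$, such that each point lies in exactly $3$ blocks and any two distinct points lie together in at most one block. A blocking set of such a configuration is a subset $Q\subseteq V$ such that every block contains at least one point of $Q$ and at least one point of $V\setminus Q$. -}

module Defs where

open import Data.Nat using (ℕ; _+_; _≤_; _<_)
open import Data.Nat.DivMod using (_/_)
open import Data.Fin using (Fin)
open import Data.Fin.Subset using (Subset; _∈_; _∉_; ∣_∣)
open import Data.Fin.Subset.Properties using (_∈?_)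
open import Data.Vec using (tabulate)
open import Data.Product using (_×_; ∃)
open import Relation.Binary.PropositionalEquality using (_≡_)
open import Relation.Nullary using (¬_)
open import Relation.Nullary.Decidable using (does)

⌈_/3⌉ : ℕ → ℕ
⌈ v /3⌉ = (v + 2) / 3

record Config₃ (v : ℕ) : Set where
  field
    block      : Fin v → Subset v
    blockSize  : ∀ b → ∣ block b ∣ ≡ 3
    pointDeg   : ∀ p → ∣ tabulate (λ b → does (p ∈? block b)) ∣ ≡ 3
    linear     : ∀ p p′ b b′ → ¬ (p ≡ p′) →
                 p ∈ block b → p′ ∈ block b → p ∈ block b′ → p′ ∈ block b′ →
                 b ≡ b′

open Config₃ public

IsBlockingSet : ∀ {v} → Config₃ v → Subset v → Set
IsBlockingSet {v} X Q =
  ∀ (b : Fin v) → (∃ λ p → p ∈ block X b × p ∈ Q) × (∃ λ p → p ∈ block X b × p ∉ Q)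

-- Call a block tight if exactly one of its points lies outside Q. Every block meets Q in one
-- or two points, in two exactly when it is tight, so counting the incidences between Q and the
-- blocks in both ways gives 3q = v + #tight. Each tight block has a single point outside Q;
-- if each of the v − q points outside Q lay on a tight block, then v − q ≤ 3q − v, i.e.
-- v ≤ 2q, contradicting q < ⌊v/2⌋. So some p ∉ Q lies on no tight block, and Q ∪ {p} is
-- still blocking: every block through p has a second point outside Q.
module Submission where

open import Data.Bool using (true; false; _∧_; if_then_else_)
open import Data.Fin using (Fin; zero; suc)
open import Data.Fin.Properties using (any?)
open import Data.Fin.Subset using (Subset; ∣_∣; _∈_; _∉_; inside; outside; ⊤; ⁅_⁆; ∁; _∩_; _∪_; Nonempty)
open import Data.Fin.Subset.Properties
  using (_∈?_; ∣p∣≤n; ∣⊥∣≡0; ∣∁p∣≡n∸∣p∣; ∣p∩q∣≤∣q∣; ∣⁅x⁆∣≡1; x∈⁅y⁆⇒x≡y; x∉⁅y⁆⇒x≢y;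
         x∈p∩q⁺; x∈p∩q⁻; x∈∁p⇒x∉p; x∉p⇒x∈∁p; x∈p∪q⁻; p⊆p∪q; x∈p⇒∣p-x∣<∣p∣;
         ∩-identityʳ; ∪-identityʳ; Empty-unique; nonempty?)
open import Data.Nat using (ℕ; zero; suc; _+_; _*_; _≤_; _<_; z≤n; s≤s; ⌊_/2⌋)
open import Data.Nat.Properties
open import Algebra.Properties.CommutativeSemigroup +-commutativeSemigroup using ()
  renaming (x∙yz≈y∙xz to x+[y+z]≡y+[x+z])
open import Algebra.Properties.CommutativeSemigroup *-commutativeSemigroup using ()
  renaming (x∙yz≈z∙yx to x*[y*z]≡z*[y*x])
open import Algebra.Properties.Semiring.Sum +-*-semiring
  using (sum-syntax; sum-cong-≗; ∑-comm; *-distribˡ-sum; *-distribʳ-sum)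
open import Data.Nat.Tactic.RingSolver using (solve-∀)
open import Data.Product using (Σ; ∃; _×_; _,_; proj₁; proj₂)
open import Data.Sum using ([_,_])
open import Data.Vec using ([]; _∷_; here; there; lookup; tabulate)
open import Data.Vec.Properties using ([]=⇒lookup; lookup⇒[]=; lookup∘tabulate; lookup-zipWith; lookup-replicate)
open import Defs
open import Function using (_∘_; _⇔_; mk⇔; Equivalence)
open import Relation.Binary.PropositionalEquality
  using (_≡_; _≢_; refl; sym; trans; cong; subst; module ≡-Reasoning)
open import Relation.Nullary using (Dec; yes; no; does)
open import Relation.Nullary.Decidable using (_×-dec_; dec-true)
open import Relation.Nullary.Negation using (contradiction)

private variable
  m n : ℕ

χ : Subset n → Fin n → ℕ
χ p i = if lookup p i then 1 else 0

χ-∈ : ∀ {p : Subset n} {i} → i ∈ p → χ p i ≡ 1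
χ-∈ i∈p = cong (if_then 1 else 0) ([]=⇒lookup i∈p)

χ-∉ : ∀ {p : Subset n} {i} → i ∉ p → χ p i ≡ 0
χ-∉ {p = p} {i} i∉p with lookup p i in eq
... | true  = contradiction (lookup⇒[]= i p eq) i∉p
... | false = refl

χ-∩ : ∀ (p q : Subset n) i → χ (p ∩ q) i ≡ χ p i * χ q i
χ-∩ p q i rewrite lookup-zipWith _∧_ i p q with lookup p i | lookup q i
... | true  | true  = refl
... | true  | false = refl
... | false | _     = refl

χ-⊤ : ∀ (i : Fin n) → χ ⊤ i ≡ 1
χ-⊤ i = cong (if_then 1 else 0) (lookup-replicate i true)

χ-cong-⇔ : ∀ {p : Subset m} {q : Subset n} {i j} → i ∈ p ⇔ j ∈ q → χ p i ≡ χ q j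
χ-cong-⇔ {p = p} {i = i} i∈p⇔j∈q with i ∈? p
... | yes i∈p = trans (χ-∈ i∈p) (sym (χ-∈ (Equivalence.to i∈p⇔j∈q i∈p)))
... | no  i∉p = trans (χ-∉ i∉p) (sym (χ-∉ (i∉p ∘ Equivalence.from i∈p⇔j∈q)))

∑-suc : ∀ (f : Fin n → ℕ) → ∑[ i < n ] suc (f i) ≡ n + ∑[ i < n ] f i
∑-suc {zero}  f = refl
∑-suc {suc n} f = cong suc (trans (cong (f zero +_) (∑-suc (f ∘ suc))) (x+[y+z]≡y+[x+z] (f zero) n _))

∑-mono-≤ : ∀ {f g : Fin n → ℕ} → (∀ i → f i ≤ g i) → ∑[ i < n ] f i ≤ ∑[ i < n ] g i
∑-mono-≤ {zero}  f≤g = z≤n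
∑-mono-≤ {suc n} f≤g = +-mono-≤ (f≤g zero) (∑-mono-≤ (f≤g ∘ suc))

∣p∣≡∑χ : ∀ (p : Subset n) → ∣ p ∣ ≡ ∑[ i < n ] χ p i
∣p∣≡∑χ [] = refl
∣p∣≡∑χ (inside  ∷ p) = cong suc (∣p∣≡∑χ p)
∣p∣≡∑χ (outside ∷ p) = ∣p∣≡∑χ p

∣p∩q∣≡∑χχ : ∀ (p q : Subset n) → ∣ p ∩ q ∣ ≡ ∑[ i < n ] (χ p i * χ q i)
∣p∩q∣≡∑χχ p q = trans (∣p∣≡∑χ (p ∩ q)) (sum-cong-≗ (χ-∩ p q))

∣p∣≤∑χf : ∀ {p : Subset n} (f : Fin n → ℕ) → (∀ i → i ∈ p → 0 < f i) → ∣ p ∣ ≤ ∑[ i < n ] (χ p i * f i)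
∣p∣≤∑χf {p = p} f pos = ≤-trans (≤-reflexive (∣p∣≡∑χ p)) (∑-mono-≤ χ≤χ*f)
  where
  χ≤χ*f : ∀ i → χ p i ≤ χ p i * f i
  χ≤χ*f i with i ∈? p
  ... | yes i∈p rewrite χ-∈ i∈p = ≤-trans (pos i i∈p) (≤-reflexive (sym (*-identityˡ (f i))))
  ... | no  i∉p rewrite χ-∉ i∉p = z≤n

∣p∩q∣+∣p∩∁q∣≡∣p∣ : ∀ (p q : Subset n) → ∣ p ∩ q ∣ + ∣ p ∩ ∁ q ∣ ≡ ∣ p ∣
∣p∩q∣+∣p∩∁q∣≡∣p∣ []            []            = refl
∣p∩q∣+∣p∩∁q∣≡∣p∣ (outside ∷ p) (_       ∷ q) = ∣p∩q∣+∣p∩∁q∣≡∣p∣ p q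
∣p∩q∣+∣p∩∁q∣≡∣p∣ (inside  ∷ p) (inside  ∷ q) = cong suc (∣p∩q∣+∣p∩∁q∣≡∣p∣ p q)
∣p∩q∣+∣p∩∁q∣≡∣p∣ (inside  ∷ p) (outside ∷ q) = trans (+-suc ∣ p ∩ q ∣ _) (cong suc (∣p∩q∣+∣p∩∁q∣≡∣p∣ p q))

∣p∪⁅x⁆∣≡1+∣p∣ : ∀ {p : Subset n} {x} → x ∉ p → ∣ p ∪ ⁅ x ⁆ ∣ ≡ suc ∣ p ∣
∣p∪⁅x⁆∣≡1+∣p∣ {p = inside  ∷ p} {zero}  x∉p = contradiction here x∉p
∣p∪⁅x⁆∣≡1+∣p∣ {p = outside ∷ p} {zero}  x∉p = cong (suc ∘ ∣_∣) (∪-identityʳ p)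
∣p∪⁅x⁆∣≡1+∣p∣ {p = inside  ∷ p} {suc x} x∉p = cong suc (∣p∪⁅x⁆∣≡1+∣p∣ (x∉p ∘ there))
∣p∪⁅x⁆∣≡1+∣p∣ {p = outside ∷ p} {suc x} x∉p = ∣p∪⁅x⁆∣≡1+∣p∣ (x∉p ∘ there)

x∈p⇒0<∣p∣ : ∀ {p : Subset n} {x} → x ∈ p → 0 < ∣ p ∣
x∈p⇒0<∣p∣ x∈p = ≤-trans (s≤s z≤n) (x∈p⇒∣p-x∣<∣p∣ x∈p)

0<∣p∣⇒Nonempty : ∀ {p : Subset n} → 0 < ∣ p ∣ → Nonempty p
0<∣p∣⇒Nonempty {n} {p} 0<∣p∣ with nonempty? p
... | yes ne    = ne
... | no  empty = contradiction (trans (cong ∣_∣ (Empty-unique empty)) (∣⊥∣≡0 n)) (>⇒≢ 0<∣p∣)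

1<∣p∣⇒∃≢ : ∀ {p : Subset n} x → 1 < ∣ p ∣ → ∃ λ y → y ∈ p × y ≢ x
1<∣p∣⇒∃≢ {p = p} x 1<∣p∣ with 0<∣p∣⇒Nonempty {p = p ∩ ∁ ⁅ x ⁆} 0<∣p∖x∣
  where
  0<∣p∖x∣ : 0 < ∣ p ∩ ∁ ⁅ x ⁆ ∣
  0<∣p∖x∣ = +-cancelˡ-< 1 0 _ (begin-strict
    1                                ≡⟨⟩
    1 + 0                            <⟨ 1<∣p∣ ⟩
    ∣ p ∣                            ≡⟨ ∣p∩q∣+∣p∩∁q∣≡∣p∣ p ⁅ x ⁆ ⟨
    ∣ p ∩ ⁅ x ⁆ ∣ + ∣ p ∩ ∁ ⁅ x ⁆ ∣  ≤⟨ +-monoˡ-≤ _ (≤-trans (∣p∩q∣≤∣q∣ p ⁅ x ⁆) (≤-reflexive (∣⁅x⁆∣≡1 x))) ⟩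
    1 + ∣ p ∩ ∁ ⁅ x ⁆ ∣              ∎)
    where open ≤-Reasoning
... | y , y∈p∖x with x∈p∩q⁻ p (∁ ⁅ x ⁆) y∈p∖x
... | y∈p , y∈∁x = y , y∈p , x∉⁅y⁆⇒x≢y (x∈∁p⇒x∉p y∈∁x)

∈-tabulate-does : ∀ {ℓ} {P : Fin n → Set ℓ} (P? : ∀ i → Dec (P i)) {i} → i ∈ tabulate (does ∘ P?) ⇔ P i
∈-tabulate-does {P = P} P? {i} = mk⇔ to from
  where
  to : i ∈ tabulate (does ∘ P?) → P i
  to i∈ with P? i | trans (sym (lookup∘tabulate (does ∘ P?) i)) ([]=⇒lookup i∈)
  ... | yes Pi | _ = Pi
  ... | no  _  | ()
  from : P i → i ∈ tabulate (does ∘ P?)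
  from Pi = lookup⇒[]= i _ (trans (lookup∘tabulate (does ∘ P?) i) (dec-true (P? i) Pi))

∑χ∣∩∣-transpose : ∀ {A : Fin m → Subset n} {B : Fin n → Subset m} →
                  (∀ i j → i ∈ B j ⇔ j ∈ A i) → ∀ (S : Subset n) (T : Subset m) →
                  ∑[ i < m ] (χ T i * ∣ A i ∩ S ∣) ≡ ∑[ j < n ] (χ S j * ∣ B j ∩ T ∣)
∑χ∣∩∣-transpose {m} {n} {A} {B} B⇔A S T = begin
  ∑[ i < m ] (χ T i * ∣ A i ∩ S ∣)                      ≡⟨ sum-cong-≗ (λ i → cong (χ T i *_) (∣p∩q∣≡∑χχ (A i) S)) ⟩
  ∑[ i < m ] (χ T i * ∑[ j < n ] (χ (A i) j * χ S j))   ≡⟨ sum-cong-≗ (λ i → *-distribˡ-sum (χ T i) (λ j → χ (A i) j * χ S j)) ⟩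
  ∑[ i < m ] ∑[ j < n ] (χ T i * (χ (A i) j * χ S j))   ≡⟨ ∑-comm (λ i j → χ T i * (χ (A i) j * χ S j)) ⟩
  ∑[ j < n ] ∑[ i < m ] (χ T i * (χ (A i) j * χ S j))   ≡⟨ sum-cong-≗ (λ j → sum-cong-≗ (λ i → swap i j)) ⟩
  ∑[ j < n ] ∑[ i < m ] (χ S j * (χ (B j) i * χ T i))   ≡⟨ sum-cong-≗ (λ j → *-distribˡ-sum (χ S j) (λ i → χ (B j) i * χ T i)) ⟨
  ∑[ j < n ] (χ S j * ∑[ i < m ] (χ (B j) i * χ T i))   ≡⟨ sum-cong-≗ (λ j → cong (χ S j *_) (∣p∩q∣≡∑χχ (B j) T)) ⟨
  ∑[ j < n ] (χ S j * ∣ B j ∩ T ∣)                      ∎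
  where
  open ≡-Reasoning
  swap : ∀ i j → χ T i * (χ (A i) j * χ S j) ≡ χ S j * (χ (B j) i * χ T i)
  swap i j rewrite χ-cong-⇔ (B⇔A i j) = x*[y*z]≡z*[y*x] (χ T i) (χ (A i) j) (χ S j)

m≤n+n⇒⌊m/2⌋≤n : m ≤ n + n → ⌊ m /2⌋ ≤ n
m≤n+n⇒⌊m/2⌋≤n {n = n} m≤n+n = subst (_ ≤_) (sym (n≡⌊n+n/2⌋ n)) (⌊n/2⌋-mono m≤n+n)

m+m≤n+n⇒m≤n : m + m ≤ n + n → m ≤ n
m+m≤n+n⇒m≤n {m} m+m≤n+n = subst (_≤ _) (sym (n≡⌊n+n/2⌋ m)) (m≤n+n⇒⌊m/2⌋≤n m+m≤n+n)

o+q≡v∧v+t≡3q∧o≤t⇒⌊v/2⌋≤q : ∀ {o q t v} → o + q ≡ v → v + t ≡ 3 * q → o ≤ t → ⌊ v /2⌋ ≤ q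
o+q≡v∧v+t≡3q∧o≤t⇒⌊v/2⌋≤q {o} {q} {t} {v} o+q≡v v+t≡3q o≤t = m≤n+n⇒⌊m/2⌋≤n (m+m≤n+n⇒m≤n (begin
  v + v                ≡⟨ cong (_+ v) o+q≡v ⟨
  o + q + v            ≤⟨ +-monoˡ-≤ v (+-monoˡ-≤ q o≤t) ⟩
  t + q + v            ≡⟨ +-comm (t + q) v ⟩
  v + (t + q)          ≡⟨ +-assoc v t q ⟨
  v + t + q            ≡⟨ cong (_+ q) v+t≡3q ⟩
  3 * q + q            ≡⟨ 3q+q≡[q+q]+[q+q] q ⟩
  (q + q) + (q + q)    ∎))
  where
  open ≤-Reasoning
  3q+q≡[q+q]+[q+q] : ∀ q → 3 * q + q ≡ (q + q) + (q + q)
  3q+q≡[q+q]+[q+q] = solve-∀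

module _ {v} (X : Config₃ v) (Q : Subset v) where

  blocksThrough : Fin v → Subset v
  blocksThrough p = tabulate (λ b → does (p ∈? block X b))

  tightBlocks : Subset v
  tightBlocks = tabulate (λ b → does (∣ block X b ∩ ∁ Q ∣ ≟ 1))

  ∈-blocksThrough : ∀ {p b} → b ∈ blocksThrough p ⇔ p ∈ block X b
  ∈-blocksThrough {p} = ∈-tabulate-does (λ b → p ∈? block X b)

  ∈-tightBlocks : ∀ {b} → b ∈ tightBlocks ⇔ ∣ block X b ∩ ∁ Q ∣ ≡ 1
  ∈-tightBlocks = ∈-tabulate-does (λ b → ∣ block X b ∩ ∁ Q ∣ ≟ 1)

  ∑χ∣block∩∣-transpose : ∀ (S T : Subset v) →
                         ∑[ b < v ] (χ T b * ∣ block X b ∩ S ∣) ≡ ∑[ p < v ] (χ S p * ∣ blocksThrough p ∩ T ∣)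
  ∑χ∣block∩∣-transpose = ∑χ∣∩∣-transpose (λ b p → ∈-blocksThrough)

  ∑∣block∩Q∣≡3∣Q∣ : ∑[ b < v ] ∣ block X b ∩ Q ∣ ≡ 3 * ∣ Q ∣
  ∑∣block∩Q∣≡3∣Q∣ = begin
    ∑[ b < v ] ∣ block X b ∩ Q ∣                    ≡⟨ sum-cong-≗ (λ b → trans (cong (_* ∣ block X b ∩ Q ∣) (χ-⊤ b)) (*-identityˡ _)) ⟨
    ∑[ b < v ] (χ ⊤ b * ∣ block X b ∩ Q ∣)          ≡⟨ ∑χ∣block∩∣-transpose Q ⊤ ⟩
    ∑[ p < v ] (χ Q p * ∣ blocksThrough p ∩ ⊤ ∣)    ≡⟨ sum-cong-≗ (λ p → cong (χ Q p *_) (trans (cong ∣_∣ (∩-identityʳ (blocksThrough p))) (pointDeg X p))) ⟩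
    ∑[ p < v ] (χ Q p * 3)                          ≡⟨ *-distribʳ-sum 3 (χ Q) ⟨
    ∑[ p < v ] χ Q p * 3                            ≡⟨ cong (_* 3) (∣p∣≡∑χ Q) ⟨
    ∣ Q ∣ * 3                                       ≡⟨ *-comm ∣ Q ∣ 3 ⟩
    3 * ∣ Q ∣                                       ∎
    where open ≡-Reasoning

  ∣tightBlocks∣≡∑over∁Q : ∣ tightBlocks ∣ ≡ ∑[ p < v ] (χ (∁ Q) p * ∣ blocksThrough p ∩ tightBlocks ∣)
  ∣tightBlocks∣≡∑over∁Q = begin
    ∣ tightBlocks ∣                                           ≡⟨ ∣p∣≡∑χ tightBlocks ⟩
    ∑[ b < v ] χ tightBlocks b                                ≡⟨ sum-cong-≗ χ≡χ*∣block∩∁Q∣ ⟩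
    ∑[ b < v ] (χ tightBlocks b * ∣ block X b ∩ ∁ Q ∣)        ≡⟨ ∑χ∣block∩∣-transpose (∁ Q) tightBlocks ⟩
    ∑[ p < v ] (χ (∁ Q) p * ∣ blocksThrough p ∩ tightBlocks ∣) ∎
    where
    open ≡-Reasoning
    χ≡χ*∣block∩∁Q∣ : ∀ b → χ tightBlocks b ≡ χ tightBlocks b * ∣ block X b ∩ ∁ Q ∣
    χ≡χ*∣block∩∁Q∣ b with b ∈? tightBlocks
    ... | yes b∈T rewrite χ-∈ b∈T | Equivalence.to ∈-tightBlocks b∈T = refl
    ... | no  b∉T rewrite χ-∉ b∉T = refl

  ∣block∩Q∣+∣block∩∁Q∣≡3 : ∀ b → ∣ block X b ∩ Q ∣ + ∣ block X b ∩ ∁ Q ∣ ≡ 3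
  ∣block∩Q∣+∣block∩∁Q∣≡3 b = trans (∣p∩q∣+∣p∩∁q∣≡∣p∣ (block X b) Q) (blockSize X b)

  module _ (blocking : IsBlockingSet X Q) where

    0<∣block∩Q∣ : ∀ b → 0 < ∣ block X b ∩ Q ∣
    0<∣block∩Q∣ b with proj₁ (blocking b)
    ... | x , x∈b , x∈Q = x∈p⇒0<∣p∣ (x∈p∩q⁺ (x∈b , x∈Q))

    0<∣block∩∁Q∣ : ∀ b → 0 < ∣ block X b ∩ ∁ Q ∣
    0<∣block∩∁Q∣ b with proj₂ (blocking b)
    ... | x , x∈b , x∉Q = x∈p⇒0<∣p∣ (x∈p∩q⁺ (x∈b , x∉p⇒x∈∁p x∉Q))

    1<∣block∩∁Q∣ : ∀ b → b ∉ tightBlocks → 1 < ∣ block X b ∩ ∁ Q ∣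
    1<∣block∩∁Q∣ b b∉T = ≤∧≢⇒< (0<∣block∩∁Q∣ b) (λ 1≡outside → b∉T (Equivalence.from ∈-tightBlocks (sym 1≡outside)))

    ∣block∩Q∣≡1+χtight : ∀ b → ∣ block X b ∩ Q ∣ ≡ suc (χ tightBlocks b)
    ∣block∩Q∣≡1+χtight b with b ∈? tightBlocks
    ... | yes b∈T rewrite χ-∈ b∈T =
      +-cancelʳ-≡ 1 (∣ block X b ∩ Q ∣) 2 (trans (cong (∣ block X b ∩ Q ∣ +_) (sym (Equivalence.to ∈-tightBlocks b∈T))) (∣block∩Q∣+∣block∩∁Q∣≡3 b))
    ... | no  b∉T rewrite χ-∉ b∉T = ≤-antisym inside≤1 (0<∣block∩Q∣ b)
      where
      inside≤1 : ∣ block X b ∩ Q ∣ ≤ 1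
      inside≤1 = +-cancelʳ-≤ 2 _ 1 (≤-trans (+-monoʳ-≤ _ (1<∣block∩∁Q∣ b b∉T)) (≤-reflexive (∣block∩Q∣+∣block∩∁Q∣≡3 b)))

    v+∣tightBlocks∣≡3∣Q∣ : v + ∣ tightBlocks ∣ ≡ 3 * ∣ Q ∣
    v+∣tightBlocks∣≡3∣Q∣ = begin
      v + ∣ tightBlocks ∣                ≡⟨ cong (v +_) (∣p∣≡∑χ tightBlocks) ⟩
      v + ∑[ b < v ] χ tightBlocks b     ≡⟨ ∑-suc (χ tightBlocks) ⟨
      ∑[ b < v ] suc (χ tightBlocks b)   ≡⟨ sum-cong-≗ ∣block∩Q∣≡1+χtight ⟨
      ∑[ b < v ] ∣ block X b ∩ Q ∣       ≡⟨ ∑∣block∩Q∣≡3∣Q∣ ⟩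
      3 * ∣ Q ∣                          ∎
      where open ≡-Reasoning

    ∃p∉Q-on-no-tightBlock : ∣ Q ∣ < ⌊ v /2⌋ →
                                    ∃ λ p → p ∉ Q × (∀ b → p ∈ block X b → b ∉ tightBlocks)
    ∃p∉Q-on-no-tightBlock ∣Q∣<⌊v/2⌋
      with any? (λ p → (p ∈? ∁ Q) ×-dec (∣ blocksThrough p ∩ tightBlocks ∣ ≟ 0))
    ... | yes (p , p∈∁Q , ∣…∣≡0) =
      p , x∈∁p⇒x∉p p∈∁Q ,
      λ b p∈b b∈T → >⇒≢ (x∈p⇒0<∣p∣ (x∈p∩q⁺ (Equivalence.from ∈-blocksThrough p∈b , b∈T))) ∣…∣≡0
    ... | no ∄p = contradiction ∣Q∣<⌊v/2⌋ (≤⇒≯ (o+q≡v∧v+t≡3q∧o≤t⇒⌊v/2⌋≤q ∣∁Q∣+∣Q∣≡v v+∣tightBlocks∣≡3∣Q∣ ∣∁Q∣≤∣tightBlocks∣))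
      where
      ∣∁Q∣+∣Q∣≡v : ∣ ∁ Q ∣ + ∣ Q ∣ ≡ v
      ∣∁Q∣+∣Q∣≡v = trans (cong (_+ ∣ Q ∣) (∣∁p∣≡n∸∣p∣ Q)) (m∸n+n≡m (∣p∣≤n Q))
      ∣∁Q∣≤∣tightBlocks∣ : ∣ ∁ Q ∣ ≤ ∣ tightBlocks ∣
      ∣∁Q∣≤∣tightBlocks∣ = ≤-trans
        (∣p∣≤∑χf _ (λ p p∈∁Q → n≢0⇒n>0 (λ ∣…∣≡0 → ∄p (p , p∈∁Q , ∣…∣≡0))))
        (≤-reflexive (sym ∣tightBlocks∣≡∑over∁Q))

    Q∪⁅p⁆-isBlockingSet : ∀ {p} → p ∉ Q → (∀ b → p ∈ block X b → b ∉ tightBlocks) → IsBlockingSet X (Q ∪ ⁅ p ⁆)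
    Q∪⁅p⁆-isBlockingSet {p} p∉Q p-free b = meets , misses
      where
      meets : ∃ λ x → x ∈ block X b × x ∈ Q ∪ ⁅ p ⁆
      meets with proj₁ (blocking b)
      ... | x , x∈b , x∈Q = x , x∈b , p⊆p∪q ⁅ p ⁆ x∈Q
      outside-≢p : ∃ λ y → y ∈ block X b × y ∉ Q × y ≢ p
      outside-≢p with p ∈? block X b
      ... | yes p∈b with 1<∣p∣⇒∃≢ p (1<∣block∩∁Q∣ b (p-free b p∈b))
      ...   | y , y∈b∩∁Q , y≢p with x∈p∩q⁻ (block X b) (∁ Q) y∈b∩∁Q
      ...     | y∈b , y∈∁Q = y , y∈b , x∈∁p⇒x∉p y∈∁Q , y≢p
      outside-≢p | no p∉b with proj₂ (blocking b)
      ... | y , y∈b , y∉Q = y , y∈b , y∉Q , λ { refl → p∉b y∈b }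
      misses : ∃ λ y → y ∈ block X b × y ∉ Q ∪ ⁅ p ⁆
      misses with outside-≢p
      ... | y , y∈b , y∉Q , y≢p = y , y∈b , [ y∉Q , y≢p ∘ x∈⁅y⁆⇒x≡y p ] ∘ x∈p∪q⁻ Q ⁅ p ⁆

theorem2 : ∀ (v : ℕ) (X : Config₃ v) (Q : Subset v) (q : ℕ) →
           IsBlockingSet X Q → ∣ Q ∣ ≡ q →
           ⌈ v /3⌉ ≤ q → q < ⌊ v /2⌋ →
           Σ (Subset v) (λ Q′ → IsBlockingSet X Q′ × ∣ Q′ ∣ ≡ suc q)
-- The lower bound ⌈ v/3⌉ ≤ q holds for every blocking set, as each block meets Q.
theorem2 v X Q q blocking refl _ q<⌊v/2⌋
  with ∃p∉Q-on-no-tightBlock X Q blocking q<⌊v/2⌋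
... | p , p∉Q , p-free = Q ∪ ⁅ p ⁆ , Q∪⁅p⁆-isBlockingSet X Q blocking p∉Q p-free , ∣p∪⁅x⁆∣≡1+∣p∣ p∉Q
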